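{- Let $\underline{D}$ be a trivial double Boolean algebra. (1) If $x,y\in D_\sqcap$, then $x\sqcup y=\bot\sqcup\bot$ and $\lrcorner x=\top$. (2) If $x,y\in D_\sqcup$, then $x\sqcap y=\top\sqcap\top$ and $\neg x=\bot$.
   Context: A double Boolean algebra (dBa) is an algebra $\underline{D}=(D;\sqcap,\sqcup,\neg,\lrcorner,\bot,\top)$ of type $(2,2,1,1,0,0)$ satisfying, for all $x,y,z$, where $x\vee y:=\neg(\neg x\sqcap\neg y)$ and $x\wedge y:=\lrcorner(\lrcorner x\sqcup\lrcorner y)$: $(x\sqcap x)\sqcap y=x\sqcap y$; $(x\sqcup x)\sqcup y=x\sqcup y$; $\sqcap$ and $\sqcup$ are commutative and associative; $x\sqcap(x\sqcup y)=x\sqcap x$; $x\sqcup(x\sqcap y)=x\sqcup x$; $x\sqcap(x\vee y)=x\sqcap x$; $x\sqcup(x\wedge y)=x\sqcup x$; $x\sqcap(y\vee z)=(x\sqcap y)\vee(x\sqcap z)$; $x\sqcup(y\wedge z)=(x\sqcup y)\wedge(x\sqcup z)$; $\neg\neg(x\sqcap y)=x\sqcap y$; $\lrcorner\lrcorner(x\sqcup y)=x\sqcup y$; $\neg(x\sqcap x)=\neg x$; $\lrcorner(x\sqcup x)=\lrcorner x$; $x\sqcap\neg x=\bot$; $x\sqcup\lrcorner x=\top$; $\neg\bot=\top\sqcap\top$; $\lrcorner\top=\bot\sqcup\bot$; $\neg\top=\bot$; $\lrcorner\bot=\top$; $(x\sqcap x)\sqcup(x\sqcap x)=(x\sqcup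 x)\sqcap(x\sqcup x)$. $D_\sqcap=\{x\in D: x\sqcap x=x\}$, $D_\sqcup=\{x\in D: x\sqcup x=x\}$. $\underline{D}$ is trivial if $\top\sqcap\top=\bot\sqcup\bot$. -}

module Defs where

open import Level using (Level; suc)
open import Relation.Binary.PropositionalEquality using (_≡_)
open import Data.Product using (_×_)

record DoubleBooleanAlgebra (c : Level) : Set (suc c) where
  infixr 7 _⊓_
  infixr 6 _⊔_
  field
    Carrier : Set c
    _⊓_ _⊔_ : Carrier → Carrier → Carrier
    ¬_ ⌟_ : Carrier → Carrier
    ⊥ ⊤ : Carrier

  _∨_ : Carrier → Carrier → Carrier
  x ∨ y = ¬ ((¬ x) ⊓ (¬ y))

  _∧_ : Carrier → Carrier → Carrier
  x ∧ y = ⌟ ((⌟ x) ⊔ (⌟ y))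

  field
    ⊓-idem-left : ∀ x y → (x ⊓ x) ⊓ y ≡ x ⊓ y
    ⊔-idem-left : ∀ x y → (x ⊔ x) ⊔ y ≡ x ⊔ y
    ⊓-comm : ∀ x y → x ⊓ y ≡ y ⊓ x
    ⊔-comm : ∀ x y → x ⊔ y ≡ y ⊔ x
    ⊓-assoc : ∀ x y z → x ⊓ (y ⊓ z) ≡ (x ⊓ y) ⊓ z
    ⊔-assoc : ∀ x y z → x ⊔ (y ⊔ z) ≡ (x ⊔ y) ⊔ z
    ⊓-absorb-⊔ : ∀ x y → x ⊓ (x ⊔ y) ≡ x ⊓ x
    ⊔-absorb-⊓ : ∀ x y → x ⊔ (x ⊓ y) ≡ x ⊔ x
    ⊓-absorb-∨ : ∀ x y → x ⊓ (x ∨ y) ≡ x ⊓ x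
    ⊔-absorb-∧ : ∀ x y → x ⊔ (x ∧ y) ≡ x ⊔ x
    ⊓-distrib-∨ : ∀ x y z → x ⊓ (y ∨ z) ≡ (x ⊓ y) ∨ (x ⊓ z)
    ⊔-distrib-∧ : ∀ x y z → x ⊔ (y ∧ z) ≡ (x ⊔ y) ∧ (x ⊔ z)
    ¬¬-⊓ : ∀ x y → ¬ (¬ (x ⊓ y)) ≡ x ⊓ y
    ⌟⌟-⊔ : ∀ x y → ⌟ (⌟ (x ⊔ y)) ≡ x ⊔ y
    ¬-⊓-idem : ∀ x → ¬ (x ⊓ x) ≡ ¬ x
    ⌟-⊔-idem : ∀ x → ⌟ (x ⊔ x) ≡ ⌟ x
    ⊓-compl : ∀ x → x ⊓ (¬ x) ≡ ⊥
    ⊔-compl : ∀ x → x ⊔ (⌟ x) ≡ ⊤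
    ¬⊥ : ¬ ⊥ ≡ ⊤ ⊓ ⊤
    ⌟⊤ : ⌟ ⊤ ≡ ⊥ ⊔ ⊥
    ¬⊤ : ¬ ⊤ ≡ ⊥
    ⌟⊥ : ⌟ ⊥ ≡ ⊤
    mixed : ∀ x → (x ⊓ x) ⊔ (x ⊓ x) ≡ (x ⊔ x) ⊓ (x ⊔ x)

  InD⊓ : Carrier → Set c
  InD⊓ x = x ⊓ x ≡ x

  InD⊔ : Carrier → Set c
  InD⊔ x = x ⊔ x ≡ x

  Trivial : Set c
  Trivial = ⊤ ⊓ ⊤ ≡ ⊥ ⊔ ⊥

{-# OPTIONS --safe #-}
-- In any dBa, ¬ ⊥ = ⊤ ⊓ ⊤ is x ∨ ¬ x, so absorption makes ⊤ ⊓ ⊤ a right unit for ⊓ up to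
-- x ⊓ x, and dually ⊥ ⊔ ⊥ for ⊔. Triviality lets x ∈ D⊓ absorb ⊥ ⊔ ⊥ under ⊓, whence
-- x ⊔ x collapses to ⊥ ⊔ ⊥ and both claims of (1) follow. Claim (2) is (1) for the
-- dual algebra obtained by exchanging ⊓/⊔, ¬/⌟ and ⊥/⊤.
module Submission where

open import Defs
open import Level using (Level)
open import Relation.Binary.PropositionalEquality using (_≡_; sym; cong; module ≡-Reasoning)
open import Data.Product using (_×_; _,_)

dual : ∀ {c} → DoubleBooleanAlgebra c → DoubleBooleanAlgebra c
dual D = record
  { Carrier = Carrier
  ; _⊓_ = _⊔_
  ; _⊔_ = _⊓_
  ; ¬_ = ⌟_
  ; ⌟_ = ¬_
  ; ⊥ = ⊤
  ; ⊤ = ⊥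
  ; ⊓-idem-left = ⊔-idem-left
  ; ⊔-idem-left = ⊓-idem-left
  ; ⊓-comm = ⊔-comm
  ; ⊔-comm = ⊓-comm
  ; ⊓-assoc = ⊔-assoc
  ; ⊔-assoc = ⊓-assoc
  ; ⊓-absorb-⊔ = ⊔-absorb-⊓
  ; ⊔-absorb-⊓ = ⊓-absorb-⊔
  ; ⊓-absorb-∨ = ⊔-absorb-∧
  ; ⊔-absorb-∧ = ⊓-absorb-∨
  ; ⊓-distrib-∨ = ⊔-distrib-∧
  ; ⊔-distrib-∧ = ⊓-distrib-∨
  ; ¬¬-⊓ = ⌟⌟-⊔
  ; ⌟⌟-⊔ = ¬¬-⊓
  ; ¬-⊓-idem = ⌟-⊔-idem
  ; ⌟-⊔-idem = ¬-⊓-idem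
  ; ⊓-compl = ⊔-compl
  ; ⊔-compl = ⊓-compl
  ; ¬⊥ = ⌟⊤
  ; ⌟⊤ = ¬⊥
  ; ¬⊤ = ⌟⊥
  ; ⌟⊥ = ¬⊤
  ; mixed = λ x → sym (mixed x)
  }
  where open DoubleBooleanAlgebra D

module _ {c : Level} (D : DoubleBooleanAlgebra c) where
  open DoubleBooleanAlgebra D
  open ≡-Reasoning

  x⊓[⊤⊓⊤]≡x⊓x : ∀ x → x ⊓ (⊤ ⊓ ⊤) ≡ x ⊓ x
  x⊓[⊤⊓⊤]≡x⊓x x = begin
    x ⊓ (⊤ ⊓ ⊤)     ≡⟨ cong (x ⊓_) (sym ¬⊥) ⟩
    x ⊓ ¬ ⊥         ≡⟨ cong (λ z → x ⊓ ¬ z) (sym (⊓-compl (¬ x))) ⟩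
    x ⊓ (x ∨ (¬ x)) ≡⟨ ⊓-absorb-∨ x (¬ x) ⟩
    x ⊓ x           ∎

module _ {c : Level} (D : DoubleBooleanAlgebra c) where
  open DoubleBooleanAlgebra D
  open ≡-Reasoning

  x⊔[⊥⊔⊥]≡x⊔x : ∀ x → x ⊔ (⊥ ⊔ ⊥) ≡ x ⊔ x
  x⊔[⊥⊔⊥]≡x⊔x = x⊓[⊤⊓⊤]≡x⊓x (dual D)

  ⊥⊔⊥∈D⊔ : InD⊔ (⊥ ⊔ ⊥)
  ⊥⊔⊥∈D⊔ = begin
    (⊥ ⊔ ⊥) ⊔ (⊥ ⊔ ⊥)   ≡⟨ ⊔-idem-left ⊥ (⊥ ⊔ ⊥) ⟩
    ⊥ ⊔ (⊥ ⊔ ⊥)         ≡⟨ x⊔[⊥⊔⊥]≡x⊔x ⊥ ⟩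
    ⊥ ⊔ ⊥               ∎

  x⊔x≡⊥⊔⊥⇒⌟x≡⊤ : ∀ x → x ⊔ x ≡ ⊥ ⊔ ⊥ → ⌟ x ≡ ⊤
  x⊔x≡⊥⊔⊥⇒⌟x≡⊤ x x⊔x≡⊥⊔⊥ = begin
    ⌟ x         ≡⟨ sym (⌟-⊔-idem x) ⟩
    ⌟ (x ⊔ x)   ≡⟨ cong ⌟_ x⊔x≡⊥⊔⊥ ⟩
    ⌟ (⊥ ⊔ ⊥)   ≡⟨ ⌟-⊔-idem ⊥ ⟩
    ⌟ ⊥         ≡⟨ ⌟⊥ ⟩
    ⊤           ∎

  ⊔-of-⊔-idem≡⊥⊔⊥ : ∀ x y → x ⊔ x ≡ ⊥ ⊔ ⊥ → y ⊔ y ≡ ⊥ ⊔ ⊥ → x ⊔ y ≡ ⊥ ⊔ ⊥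
  ⊔-of-⊔-idem≡⊥⊔⊥ x y x⊔x≡⊥⊔⊥ y⊔y≡⊥⊔⊥ = begin
    x ⊔ y           ≡⟨ sym (⊔-idem-left x y) ⟩
    (x ⊔ x) ⊔ y     ≡⟨ cong (_⊔ y) x⊔x≡⊥⊔⊥ ⟩
    (⊥ ⊔ ⊥) ⊔ y     ≡⟨ ⊔-comm (⊥ ⊔ ⊥) y ⟩
    y ⊔ (⊥ ⊔ ⊥)     ≡⟨ x⊔[⊥⊔⊥]≡x⊔x y ⟩
    y ⊔ y           ≡⟨ y⊔y≡⊥⊔⊥ ⟩
    ⊥ ⊔ ⊥           ∎

  module _ (trivial : Trivial) where

    InD⊓⇒x⊔x≡⊥⊔⊥ : ∀ x → InD⊓ x → x ⊔ x ≡ ⊥ ⊔ ⊥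
    InD⊓⇒x⊔x≡⊥⊔⊥ x x⊓x≡x = begin
      x ⊔ x                     ≡⟨ sym (x⊔[⊥⊔⊥]≡x⊔x x) ⟩
      x ⊔ (⊥ ⊔ ⊥)               ≡⟨ ⊔-comm x (⊥ ⊔ ⊥) ⟩
      (⊥ ⊔ ⊥) ⊔ x               ≡⟨ cong ((⊥ ⊔ ⊥) ⊔_) x≡[⊥⊔⊥]⊓x ⟩
      (⊥ ⊔ ⊥) ⊔ ((⊥ ⊔ ⊥) ⊓ x)   ≡⟨ ⊔-absorb-⊓ (⊥ ⊔ ⊥) x ⟩
      (⊥ ⊔ ⊥) ⊔ (⊥ ⊔ ⊥)         ≡⟨ ⊥⊔⊥∈D⊔ ⟩
      ⊥ ⊔ ⊥                     ∎
      where
      x≡[⊥⊔⊥]⊓x : x ≡ (⊥ ⊔ ⊥) ⊓ x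
      x≡[⊥⊔⊥]⊓x = begin
        x             ≡⟨ sym x⊓x≡x ⟩
        x ⊓ x         ≡⟨ sym (x⊓[⊤⊓⊤]≡x⊓x D x) ⟩
        x ⊓ (⊤ ⊓ ⊤)   ≡⟨ cong (x ⊓_) trivial ⟩
        x ⊓ (⊥ ⊔ ⊥)   ≡⟨ ⊓-comm x (⊥ ⊔ ⊥) ⟩
        (⊥ ⊔ ⊥) ⊓ x   ∎

    trivial⇒D⊓-collapses : ∀ x y → InD⊓ x → InD⊓ y → (x ⊔ y ≡ ⊥ ⊔ ⊥) × (⌟ x ≡ ⊤)
    trivial⇒D⊓-collapses x y x∈D⊓ y∈D⊓ =
      ⊔-of-⊔-idem≡⊥⊔⊥ x y (InD⊓⇒x⊔x≡⊥⊔⊥ x x∈D⊓) (InD⊓⇒x⊔x≡⊥⊔⊥ y y∈D⊓)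
      , x⊔x≡⊥⊔⊥⇒⌟x≡⊤ x (InD⊓⇒x⊔x≡⊥⊔⊥ x x∈D⊓)

proposition3p3 : ∀ {c : Level} (D : DoubleBooleanAlgebra c) → let open DoubleBooleanAlgebra D in
    Trivial →
    (∀ x y → InD⊓ x → InD⊓ y → (x ⊔ y ≡ ⊥ ⊔ ⊥) × (⌟ x ≡ ⊤))
    × (∀ x y → InD⊔ x → InD⊔ y → (x ⊓ y ≡ ⊤ ⊓ ⊤) × (¬ x ≡ ⊥))
proposition3p3 D trivial = trivial⇒D⊓-collapses D trivial , trivial⇒D⊓-collapses (dual D) (sym trivial)
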